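{- Let $G$ be a totally decomposable graph with reduced clique-star split-decomposition tree $T$. Then $G$ has no pendant edge if and only if $T$ has no star-node $u$ such that both the center of $G_u$ and some extremity of $G_u$ are attached to leaves of $T$.
   Context: All graphs are finite, simple and connected. A pendant edge is an edge having an endpoint of degree 1. A graph-labeled tree $(T,\mathcal{F})$ is a tree $T$ in which each internal node $v$, of degree $k$, carries a graph $G_v$ on $k$ vertices (its marker vertices) and a bijection $\rho_v$ from the tree edges incident to $v$ onto $V(G_v)$; edges of $G_v$ are interior edges. For a marker vertex $x$ of $G_v$, the leaf or node at the other end of the tree edge $\rho_v^{ -1}(x)$ is said to be attached to $x$. A clique-node is an internal node $v$ with $G_v$ complete; a star-node is one with $G_v$ a star $K_{1,k-1}$, whose vertex adjacent to all others is its center and whose other vertices are its extremities. Form the auxiliary graph whose vertices are the leaves of $T$ and all marker vertices, and whose edges are all interior edges together with, for each tree edge $e=\{v,w\}$, an edge joining $\rho_v(e)$ (or $v$ if $v$ is a leaf) to $\rho_w(e)$ (or $w$ if $w$ is a leaf). An alternated path is a path in this auxiliary graph containing at most one interior edge of each $G_v$. The accessibility graph of $(T,\mathcal{F})$ has the leaves of $T$ as vertices, two leaves being adjacent iff an alternated path joins them. A split of a graph $H$ is a bipartition $(V_1,V_2)$ of $V(H)$ with $|V_1|,|V_2|\ge 2$ such that every vertex of $V_1$ with a neighbour in $V_2$ is adjacent to every vertex of $V_2$ with a neighbour in $V_1$; a graph with no split is prime. (Cunningham) Every connected graph $G$ is the accessibility graph, with leaves identified with $V(G)$, of a unique graph-labeled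 tree, its reduced split-decomposition tree, in which every label is a prime graph, a clique or a star, every internal node has degree at least 3, no tree edge joins two clique-nodes, and no tree edge joins the center of a star-node to an extremity of another star-node. It is a clique-star tree if all labels are cliques or stars, and $G$ is then called totally decomposable (equivalently, distance-hereditary). -}

module Defs where

open import Data.Nat using (ℕ; _≤_)
open import Data.Fin using (Fin; _≟_)
open import Data.Bool using (Bool; true; false)
open import Data.List using (List; []; _∷_; length; filter; filterᵇ; allFin)
open import Data.List.Relation.Unary.Unique.Propositional using (Unique)
open import Data.Sum using (_⊎_; inj₁; inj₂; [_,_])
open import Data.Product using (Σ; ∃; _×_; _,_)
open import Data.Empty using (⊥)
open import Relation.Nullary using (¬_)
open import Relation.Binary.PropositionalEquality using (_≡_; _≢_)
open import Function.Bundles using (_⇔_)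

data Walk {A : Set} (R : A → A → Set) : A → A → Set where
  []  : ∀ {a} → Walk R a a
  _∷_ : ∀ {a b c} → R a b → Walk R b c → Walk R a c

verts : ∀ {A : Set} {R : A → A → Set} {a b : A} → Walk R a b → List A
verts {a = a} []      = a ∷ []
verts {a = a} (_ ∷ w) = a ∷ verts w

Cycle : ∀ {A : Set} → (A → A → Set) → Set
Cycle {A} R = Σ A λ a → Σ A λ b → Σ (Walk R a b) λ w →
  R b a × 3 ≤ length (verts w) × Unique (verts w)

record Graph (n : ℕ) : Set where
  field
    adj       : Fin n → Fin n → Bool
    adj-sym   : ∀ a b → adj a b ≡ adj b a
    adj-irr   : ∀ a → adj a a ≡ false
    connected : ∀ a b → Walk (λ u v → adj u v ≡ true) a b

module _ {n : ℕ} (G : Graph n) where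
  open Graph G

  degree : Fin n → ℕ
  degree a = length (filterᵇ (adj a) (allFin n))

  HasPendantEdge : Set
  HasPendantEdge = Σ (Fin n) λ a → Σ (Fin n) λ b →
    adj a b ≡ true × (degree a ≡ 1 ⊎ degree b ≡ 1)

-- Graph-labeled trees with n leaves (leaves = Fin n), m internal nodes
-- and k marker vertices.  Marker x belongs to internal node (node x);
-- the tree edge ρ⁻¹(x) joins node x to the leaf / the marker  other x
-- at its other end.  label is the union of the label graphs G_v
-- (interior edges).

record GLT (n : ℕ) : Set where
  field
    m k   : ℕ
    node  : Fin k → Fin m
    other : Fin k → Fin n ⊎ Fin k
    label : Fin k → Fin k → Bool

module _ {n : ℕ} (T : GLT n) where
  open GLT T

  TV : Set
  TV = Fin n ⊎ Fin m

  end : Fin k → TV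
  end x = [ inj₁ , (λ y → inj₂ (node y)) ] (other x)

  TAdj : TV → TV → Set
  TAdj s t = Σ (Fin k) λ x →
    (inj₂ (node x) ≡ s × end x ≡ t) ⊎ (end x ≡ s × inj₂ (node x) ≡ t)

  degreeT : Fin m → ℕ
  degreeT v = length (filter (λ x → node x ≟ v) (allFin k))

  -- well-formedness: each G_v is a simple graph on the markers of v,
  -- tree edges are well matched, every leaf has degree 1, the ρ_v are
  -- bijections (no two markers of v lead to the same neighbour), and T
  -- is a tree (connected, acyclic).
  record IsGLT : Set where
    field
      label-sym    : ∀ x y → label x y ≡ label y x
      label-irr    : ∀ x → label x x ≡ false
      label-local  : ∀ x y → label x y ≡ true → node x ≡ node y
      other-inv    : ∀ x y → other x ≡ inj₂ y → other y ≡ inj₂ x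
      no-loop      : ∀ x y → other x ≡ inj₂ y → node x ≢ node y
      leaf-attach  : ∀ l → Σ (Fin k) λ x → other x ≡ inj₁ l
      leaf-unique  : ∀ x y l → other x ≡ inj₁ l → other y ≡ inj₁ l → x ≡ y
      incidence-inj : ∀ x y → node x ≡ node y → end x ≡ end y → x ≡ y
      tree-connected : ∀ s t → Walk TAdj s t
      tree-acyclic   : ¬ Cycle TAdj

  IsClique : Fin m → Set
  IsClique v = ∀ x y → node x ≡ v → node y ≡ v → x ≢ y → label x y ≡ true

  IsStarCenter : Fin m → Fin k → Set
  IsStarCenter v c = node c ≡ v ×
    (∀ x y → node x ≡ v → node y ≡ v →
       (label x y ≡ true ⇔ (x ≢ y × (x ≡ c ⊎ y ≡ c))))

  IsStar : Fin m → Set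
  IsStar v = Σ (Fin k) (IsStarCenter v)

  IsExtremity : Fin m → Fin k → Set
  IsExtremity v e = node e ≡ v × Σ (Fin k) λ c → IsStarCenter v c × e ≢ c

  AttachedToLeaf : Fin k → Set
  AttachedToLeaf x = Σ (Fin n) λ l → other x ≡ inj₁ l

  record IsReducedCliqueStar : Set where
    field
      clique-star : ∀ v → IsClique v ⊎ IsStar v
      degree≥3    : ∀ v → 3 ≤ degreeT v
      no-clique-clique : ∀ x y → other x ≡ inj₂ y →
                         IsClique (node x) → IsClique (node y) → ⊥
      no-center-extremity : ∀ x y → other x ≡ inj₂ y →
                         IsStarCenter (node x) x → IsExtremity (node y) y → ⊥

  AV : Set
  AV = Fin n ⊎ Fin k

  data Step : AV → AV → Set where
    tree-out : ∀ x → Step (inj₂ x) (other x)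
    tree-in  : ∀ x → Step (other x) (inj₂ x)
    interior : ∀ x y → label x y ≡ true → Step (inj₂ x) (inj₂ y)

  interiorNodes : ∀ {a b} → Walk Step a b → List (Fin m)
  interiorNodes []                      = []
  interiorNodes (tree-out _ ∷ w)       = interiorNodes w
  interiorNodes (tree-in _ ∷ w)        = interiorNodes w
  interiorNodes (interior x _ _ ∷ w)   = node x ∷ interiorNodes w

  IsAlternatedPath : ∀ {a b} → Walk Step a b → Set
  IsAlternatedPath w = Unique (verts w) × Unique (interiorNodes w)

  Accessible : Fin n → Fin n → Set
  Accessible a b = a ≢ b ×
    Σ (Walk Step (inj₁ a) (inj₁ b)) IsAlternatedPath

  IsAccessibilityGraphOf : Graph n → Set
  IsAccessibilityGraphOf G = ∀ a b → (Graph.adj G a b ≡ true ⇔ Accessible a b)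

  HasStarWithLeafCenterAndExtremity : Set
  HasStarWithLeafCenterAndExtremity =
    Σ (Fin m) λ u → Σ (Fin k) λ c → Σ (Fin k) λ e →
      IsStarCenter u c × IsExtremity u e × AttachedToLeaf c × AttachedToLeaf e

-- A leaf a attached to a marker x is adjacent exactly to the leaves reached by alternated paths
-- a → x → y → …, with y an interior neighbour of x.  Descending from such a y (cross the tree edge,
-- take any interior edge, repeat) always ends at a leaf, and because T is a tree, descents from
-- distinct markers of one node end at distinct leaves.  Hence a has degree 1 only when x has a single
-- interior neighbour, i.e. x is an extremity of a star with center c.  If c is attached to a leaf this
-- is the forbidden configuration; otherwise c is attached to a marker c′ which, T being reduced, is not
-- a star extremity, so it has two interior neighbours and a gets two neighbours after all.  Conversely,
-- if the center c and an extremity e of a star carry leaves, every alternated path from the leaf at e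
-- is forced through e, c and out to the leaf at c, which is therefore its only neighbour.

module Submission where

open import Defs
open import Data.Nat using (ℕ; zero; suc; _≤_; _<_; z≤n; s≤s; _+_)
open import Data.Nat.Properties using (+-suc; +-identityʳ; n≤1+n; ≮⇒≥; <⇒≱)
open import Data.Fin using (Fin; zero; suc; _≟_) renaming (_<_ to _<ᶠ_)
open import Data.Fin.Properties using (pigeonhole)
open import Data.Bool using (true)
open import Data.Bool.Properties using (T-≡; T?)
open import Data.List using (List; []; _∷_; length; filter; allFin; lookup; map)
open import Data.List.Relation.Unary.Any using (here; there; any?)
open import Data.List.Relation.Unary.All using (All; []; _∷_)
import Data.List.Relation.Unary.All as All
open import Data.List.Relation.Unary.All.Properties using (¬Any⇒All¬)
open import Data.List.Relation.Unary.AllPairs using ([]; _∷_)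
open import Data.List.Relation.Unary.Unique.Propositional using (Unique)
open import Data.List.Relation.Unary.Unique.Propositional.Properties using (filter⁺; allFin⁺; map⁺)
open import Data.List.Membership.Propositional using (_∈_; _∉_)
open import Data.List.Membership.Propositional.Properties using (∈-filter⁺; ∈-filter⁻; ∈-allFin; ∈-map⁺; ∈-lookup)
open import Data.List.Relation.Binary.Sublist.Propositional using (_⊆_; []; _∷_; _∷ʳ_; ⊆-refl; ⊆-trans; minimum)
open import Data.List.Relation.Binary.Sublist.Propositional.Properties using (All-resp-⊆)
open import Data.Sum using (_⊎_; inj₁; inj₂; [_,_])
open import Data.Sum.Properties using (inj₁-injective; inj₂-injective; ≡-dec)
open import Data.Product using (Σ; _×_; _,_; proj₁; proj₂)
open import Data.Empty using (⊥-elim)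
open import Function using (_∘_)
open import Function.Bundles using (_⇔_; mk⇔; Equivalence)
open import Relation.Nullary using (¬_; yes; no)
open import Relation.Unary using (Decidable)
open import Relation.Binary.Definitions using (DecidableEquality)
open import Relation.Binary.PropositionalEquality using (_≡_; _≢_; refl; sym; trans; cong; subst; module ≡-Reasoning)

private
  variable
    A : Set

Unique-resp-⊇ : {xs ys : List A} → xs ⊆ ys → Unique ys → Unique xs
Unique-resp-⊇ []         []       = []
Unique-resp-⊇ (_ ∷ʳ τ)   (_ ∷ u)  = Unique-resp-⊇ τ u
Unique-resp-⊇ (refl ∷ τ) (x∉ ∷ u) = All-resp-⊆ τ x∉ ∷ Unique-resp-⊇ τ u

lookup-injective : {xs : List A} → Unique xs → ∀ {i j} → i <ᶠ j → lookup xs i ≢ lookup xs j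
lookup-injective (_ ∷ _)  {zero}  {zero}  ()
lookup-injective (x∉ ∷ _) {zero}  {suc j} _ = All.lookup x∉ (∈-lookup j)
lookup-injective (_ ∷ _)  {suc i} {zero}  ()
lookup-injective (_ ∷ u)  {suc i} {suc j} (s≤s i<j) = lookup-injective u i<j

Unique⇒length≤ : ∀ {m} (xs : List (Fin m)) → Unique xs → length xs ≤ m
Unique⇒length≤ xs u = ≮⇒≥ λ m<len →
  let (i , j , i<j , lookupᵢ≡lookupⱼ) = pigeonhole m<len (lookup xs)
  in lookup-injective u i<j lookupᵢ≡lookupⱼ

two-others : DecidableEquality A → (xs : List A) → Unique xs → 3 ≤ length xs → (x : A) →
             Σ A λ y₁ → Σ A λ y₂ → y₁ ∈ xs × y₂ ∈ xs × y₁ ≢ x × y₂ ≢ x × y₁ ≢ y₂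
two-others _ []           _ ()             _
two-others _ (_ ∷ [])     _ (s≤s ())       _
two-others _ (_ ∷ _ ∷ []) _ (s≤s (s≤s ())) _
two-others eq? (z₁ ∷ z₂ ∷ z₃ ∷ _) ((z₁≢z₂ ∷ z₁≢z₃ ∷ _) ∷ (z₂≢z₃ ∷ _) ∷ _) _ x with eq? x z₁ | eq? x z₂
... | yes refl | _        = z₂ , z₃ , there (here refl) , there (there (here refl)) , z₁≢z₂ ∘ sym , z₁≢z₃ ∘ sym , z₂≢z₃
... | no x≢z₁  | yes refl = z₁ , z₃ , here refl , there (there (here refl)) , x≢z₁ ∘ sym , z₂≢z₃ ∘ sym , z₁≢z₃
... | no x≢z₁  | no x≢z₂  = z₁ , z₂ , here refl , there (here refl) , x≢z₁ ∘ sym , x≢z₂ ∘ sym , z₁≢z₂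

module _ {P : A → Set} (P? : Decidable P) where

  filter-length≡1⇒ : ∀ {xs x y} → length (filter P? xs) ≡ 1 → x ∈ xs → y ∈ xs → P x → P y → x ≡ y
  filter-length≡1⇒ {xs} len x∈ y∈ px py
    with filter P? xs | ∈-filter⁺ P? x∈ px | ∈-filter⁺ P? y∈ py
  ... | _ ∷ [] | here refl | here refl = refl

  filter-length≡1⇐ : ∀ {xs x} → Unique xs → x ∈ xs → P x → (∀ {y} → y ∈ xs → P y → y ≡ x) →
                     length (filter P? xs) ≡ 1
  filter-length≡1⇐ u x∈ px only =
    singleton (filter⁺ P? u) (∈-filter⁺ P? x∈ px) (λ y∈ → let (y∈xs , py) = ∈-filter⁻ P? y∈ in only y∈xs py)
    where
      singleton : ∀ {ys x} → Unique ys → x ∈ ys → (∀ {y} → y ∈ ys → y ≡ x) → length ys ≡ 1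
      singleton (_ ∷ [])        _ _    = refl
      singleton ((y≢z ∷ _) ∷ _) _ only = ⊥-elim (y≢z (trans (only (here refl)) (sym (only (there (here refl))))))

module _ {R : A → A → Set} where

  All-verts-head : ∀ {P : A → Set} {a b} (w : Walk R a b) → All P (verts w) → P a
  All-verts-head []      (pa ∷ _) = pa
  All-verts-head (_ ∷ _) (pa ∷ _) = pa

  prefix : ∀ {a b c} (w : Walk R a b) → c ∈ verts w → Σ (Walk R a c) λ p → verts p ⊆ verts w
  prefix []      (here refl) = [] , ⊆-refl
  prefix (_ ∷ w) (here refl) = [] , refl ∷ minimum _
  prefix (r ∷ w) (there c∈)  = let (p , p⊆w) = prefix w c∈ in r ∷ p , refl ∷ p⊆w

  length-verts-nonzero : ∀ {a b} (w : Walk R a b) → 1 ≤ length (verts w)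
  length-verts-nonzero []      = s≤s z≤n
  length-verts-nonzero (_ ∷ _) = s≤s z≤n

  acyclic-back-edge : ¬ Cycle R → ∀ {a b c d} → R c a → (r : R a b) (w : Walk R b d) →
                      Unique (verts (r ∷ w)) → c ∈ verts w → c ≡ b
  acyclic-back-edge _ _ _ []      _ (here refl) = refl
  acyclic-back-edge _ _ _ (_ ∷ _) _ (here refl) = refl
  acyclic-back-edge acyclic {a} {c = c} back r (s ∷ w) u (there c∈) with prefix w c∈
  ... | p , p⊆w =
    ⊥-elim (acyclic (a , c , r ∷ s ∷ p , back , s≤s (s≤s (length-verts-nonzero p)) , Unique-resp-⊇ (refl ∷ refl ∷ p⊆w) u))

module Tree {n : ℕ} (𝒯 : GLT n) (isGLT : IsGLT 𝒯) (reduced : IsReducedCliqueStar 𝒯) where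
  open GLT 𝒯
  open IsGLT isGLT
  open IsReducedCliqueStar reduced

  label⇒≢ : ∀ {x y} → label x y ≡ true → x ≢ y
  label⇒≢ {x} lab refl with trans (sym lab) (label-irr x)
  ... | ()

  end-of-marker : ∀ {x y} → other x ≡ inj₂ y → end 𝒯 x ≡ inj₂ (node y)
  end-of-marker = cong [ inj₁ , inj₂ ∘ node ]

  tree-edge : ∀ {x y v} → node x ≡ v → other x ≡ inj₂ y → TAdj 𝒯 (inj₂ (node y)) (inj₂ v)
  tree-edge {x} nx px = x , inj₂ (end-of-marker px , cong inj₂ nx)

  at? : (v : Fin m) → Decidable (λ y → node y ≡ v)
  at? v y = node y ≟ v

  two-other-markers : ∀ x → Σ (Fin k) λ y₁ → Σ (Fin k) λ y₂ →
                      node y₁ ≡ node x × node y₂ ≡ node x × y₁ ≢ x × y₂ ≢ x × y₁ ≢ y₂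
  two-other-markers x
    with two-others _≟_ (filter (at? (node x)) (allFin k)) (filter⁺ (at? (node x)) (allFin⁺ k)) (degree≥3 (node x)) x
  ... | y₁ , y₂ , y₁∈ , y₂∈ , y₁≢x , y₂≢x , y₁≢y₂ =
    y₁ , y₂ , at-x y₁∈ , at-x y₂∈ , y₁≢x , y₂≢x , y₁≢y₂
    where
      at-x : ∀ {y} → y ∈ filter (at? (node x)) (allFin k) → node y ≡ node x
      at-x y∈ = proj₂ (∈-filter⁻ (at? (node x)) {xs = allFin k} y∈)

  third-marker : ∀ x y → Σ (Fin k) λ z → node z ≡ node x × z ≢ x × z ≢ y
  third-marker x y with two-other-markers x
  ... | y₁ , y₂ , n₁ , n₂ , y₁≢x , y₂≢x , y₁≢y₂ with y₁ ≟ y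
  ...   | yes refl = y₂ , n₂ , y₂≢x , y₁≢y₂ ∘ sym
  ...   | no y₁≢y  = y₁ , n₁ , y₁≢x , y₁≢y

  extremity-center-label : ∀ {u c e} → IsStarCenter 𝒯 u c → node e ≡ u → e ≢ c → label e c ≡ true
  extremity-center-label (nc , star) ne e≢c = Equivalence.from (star _ _ ne nc) (e≢c , inj₂ refl)

  star-center-unique : ∀ {u c c′} → IsStarCenter 𝒯 u c → IsStarCenter 𝒯 u c′ → c ≡ c′
  star-center-unique {c = c} {c′} (nc , star) sc′ with c ≟ c′
  ... | yes c≡c′ = c≡c′
  ... | no c≢c′ with third-marker c c′
  ...   | z , nz , z≢c , z≢c′ with Equivalence.to (star z c′ (trans nz nc) (proj₁ sc′))
                                     (extremity-center-label sc′ (trans nz nc) z≢c′)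
  ...     | _ , inj₁ z≡c  = ⊥-elim (z≢c z≡c)
  ...     | _ , inj₂ c′≡c = ⊥-elim (c≢c′ (sym c′≡c))

  Branching : Fin k → Set
  Branching z = Σ (Fin k) λ y₁ → Σ (Fin k) λ y₂ → label z y₁ ≡ true × label z y₂ ≡ true × y₁ ≢ y₂

  branching⊎extremity : ∀ z → Branching z ⊎ IsExtremity 𝒯 (node z) z
  branching⊎extremity z with two-other-markers z | clique-star (node z)
  ... | y₁ , y₂ , n₁ , n₂ , y₁≢z , y₂≢z , y₁≢y₂ | inj₁ clique =
    inj₁ (y₁ , y₂ , clique z y₁ refl n₁ (y₁≢z ∘ sym) , clique z y₂ refl n₂ (y₂≢z ∘ sym) , y₁≢y₂)
  ... | y₁ , y₂ , n₁ , n₂ , y₁≢z , y₂≢z , y₁≢y₂ | inj₂ (c , sc@(_ , star)) with z ≟ c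
  ...   | yes z≡c = inj₁ (y₁ , y₂ , center-label n₁ y₁≢z , center-label n₂ y₂≢z , y₁≢y₂)
    where
      center-label : ∀ {y} → node y ≡ node z → y ≢ z → label z y ≡ true
      center-label ny y≢z = Equivalence.from (star z _ refl ny) (y≢z ∘ sym , inj₁ z≡c)
  ...   | no z≢c  = inj₂ (refl , c , sc , z≢c)

  label-neighbour : ∀ z → Σ (Fin k) λ y → label z y ≡ true
  label-neighbour z with branching⊎extremity z
  ... | inj₁ (y , _ , lab , _)  = y , lab
  ... | inj₂ (nz , c , sc , z≢c) = c , extremity-center-label sc nz z≢c

  -- A route through 𝒯 that has just entered its current node through marker e, never turning back.
  data Route : Fin k → Set where
    start  : ∀ e → Route e
    extend : ∀ {e e′} → Route e → (x : Fin k) → x ≢ e → node x ≡ node e → other x ≡ inj₂ e′ → Route e′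

  origin : ∀ {e} → Route e → Fin k
  origin (start e)           = e
  origin (extend w _ _ _ _)  = origin w

  routeNodes : ∀ {e} → Route e → List (Fin m)
  routeNodes (start e)                    = node e ∷ []
  routeNodes (extend {e′ = e′} w _ _ _ _) = node e′ ∷ routeNodes w

  routeWalk : ∀ {e} (w : Route e) → Walk (TAdj 𝒯) (inj₂ (node e)) (inj₂ (node (origin w)))
  routeWalk (start e)            = []
  routeWalk (extend w _ _ nx px) = tree-edge nx px ∷ routeWalk w

  verts-routeWalk : ∀ {e} (w : Route e) → verts (routeWalk w) ≡ map inj₂ (routeNodes w)
  verts-routeWalk (start e)          = refl
  verts-routeWalk (extend w _ _ _ _) = cong (_ ∷_) (verts-routeWalk w)

  origin∈routeNodes : ∀ {e} (w : Route e) → node (origin w) ∈ routeNodes w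
  origin∈routeNodes (start e)          = here refl
  origin∈routeNodes (extend w _ _ _ _) = there (origin∈routeNodes w)

  route-never-revisits : ∀ {e e′ x} (w : Route e) → Unique (routeNodes w) →
                         x ≢ e → node x ≡ node e → other x ≡ inj₂ e′ → node e′ ∉ routeNodes w
  route-never-revisits {x = x} (start _)          _ _ nx px (here ne′≡ne) = no-loop x _ px (trans nx (sym ne′≡ne))
  route-never-revisits {x = x} (extend _ _ _ _ _) _ _ nx px (here ne′≡ne) = no-loop x _ px (trans nx (sym ne′≡ne))
  route-never-revisits {e} {e′} {x} w@(extend {e₁} w₁ x₁ _ nx₁ p₁) u x≢e nx px (there e′∈)
    with acyclic-back-edge tree-acyclic (tree-edge nx px) (tree-edge nx₁ p₁) (routeWalk w₁)
           (subst Unique (sym (verts-routeWalk w)) (map⁺ inj₂-injective u))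
           (subst (inj₂ (node e′) ∈_) (sym (verts-routeWalk w₁)) (∈-map⁺ inj₂ e′∈))
  ... | ne′≡ne₁ = x≢e (incidence-inj x e nx (begin
      end 𝒯 x             ≡⟨ end-of-marker px ⟩
      inj₂ (node e′)      ≡⟨ ne′≡ne₁ ⟩
      inj₂ (node e₁)      ≡⟨ cong inj₂ (sym nx₁) ⟩
      inj₂ (node x₁)      ≡⟨ sym (end-of-marker (other-inv x₁ e p₁)) ⟩
      end 𝒯 e             ∎))
    where open ≡-Reasoning

  routeNodes-unique : ∀ {e} (w : Route e) → Unique (routeNodes w)
  routeNodes-unique (start e)              = [] ∷ []
  routeNodes-unique (extend w x x≢e nx px) =
    ¬Any⇒All¬ _ (route-never-revisits w (routeNodes-unique w) x≢e nx px) ∷ routeNodes-unique w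

  route-leaves-distinct : ∀ {e q a l} (w : Route e) → other (origin w) ≡ inj₁ l →
                          q ≢ e → node q ≡ node e → other q ≡ inj₁ a → a ≢ l
  route-leaves-distinct (start e) pl q≢e _ pq refl = q≢e (leaf-unique _ e _ pq pl)
  route-leaves-distinct {q = q} w@(extend w₁ _ _ _ _) pl _ nq pq refl with routeNodes-unique w
  ... | ne∉ ∷ _ = All.lookup ne∉ (origin∈routeNodes w₁) (trans (sym nq) (cong node (leaf-unique q _ _ pq pl)))

  -- An alternated walk that leaves through marker y, crosses one interior edge at every node it enters, and ends at leaf l.
  data Descent : Fin k → Fin n → Set where
    exit  : ∀ {y l} → other y ≡ inj₁ l → Descent y l
    enter : ∀ {y e x l} → other y ≡ inj₂ e → label e x ≡ true → Descent x l → Descent y l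

  descent-route : ∀ {y l} → Descent y l → Route y
  descent-route (exit {y} _)             = start y
  descent-route (enter {y} {e} py lab d) =
    extend (descent-route d) e (label⇒≢ lab) (label-local _ _ lab) (other-inv y e py)

  descent-route-origin : ∀ {y l} (d : Descent y l) → other (origin (descent-route d)) ≡ inj₁ l
  descent-route-origin (exit py)     = py
  descent-route-origin (enter _ _ d) = descent-route-origin d

  route-descent-leaves-distinct : ∀ {e z l l′} (w : Route e) → other (origin w) ≡ inj₁ l →
                                  z ≢ e → node z ≡ node e → Descent z l′ → l′ ≢ l
  route-descent-leaves-distinct w pl z≢e nz (exit pz) = route-leaves-distinct w pl z≢e nz pz
  route-descent-leaves-distinct w pl z≢e nz (enter pz lab d) =
    route-descent-leaves-distinct (extend w _ z≢e nz pz) pl (label⇒≢ lab ∘ sym) (sym (label-local _ _ lab)) d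

  descents-distinct : ∀ {y₁ y₂ l₁ l₂} → Descent y₁ l₁ → y₂ ≢ y₁ → node y₂ ≡ node y₁ → Descent y₂ l₂ → l₂ ≢ l₁
  descents-distinct d₁ = route-descent-leaves-distinct (descent-route d₁) (descent-route-origin d₁)

  -- Fuel exceeding m suffices, as the nodes of a route are distinct.
  descend : ∀ fuel {e y} (w : Route e) → m < length (routeNodes w) + fuel → label e y ≡ true → Σ (Fin n) (Descent y)
  descend zero w bound _ =
    ⊥-elim (<⇒≱ bound (subst (_≤ m) (sym (+-identityʳ _)) (Unique⇒length≤ _ (routeNodes-unique w))))
  descend (suc fuel) {e} {y} w bound lab with other y in py
  ... | inj₁ l  = l , exit py
  ... | inj₂ e′ with label-neighbour e′
  ...   | x , lab′ with descend fuel (extend w y (label⇒≢ lab ∘ sym) (sym (label-local e y lab)) py)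
                                  (subst (m <_) (+-suc _ fuel) bound) lab′
  ...     | l , d = l , enter py lab′ d

  descent : ∀ {z y} → label z y ≡ true → Σ (Fin n) (Descent y)
  descent = descend (suc m) (start _) (s≤s (n≤1+n m))

  DistinctDescents : Fin k → Fin k → Set
  DistinctDescents y₁ y₂ = Σ (Fin n) λ l₁ → Σ (Fin n) λ l₂ → Descent y₁ l₁ × Descent y₂ l₂ × l₁ ≢ l₂

  branching-descents : ∀ {z} → Branching z → Σ (Fin k) λ y₁ → Σ (Fin k) λ y₂ →
                       label z y₁ ≡ true × label z y₂ ≡ true × DistinctDescents y₁ y₂
  branching-descents (y₁ , y₂ , lab₁ , lab₂ , y₁≢y₂) with descent lab₁ | descent lab₂
  ... | l₁ , d₁ | l₂ , d₂ =
    y₁ , y₂ , lab₁ , lab₂ , l₁ , l₂ , d₁ , d₂ ,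
    descents-distinct d₁ (y₁≢y₂ ∘ sym) (trans (sym (label-local _ _ lab₂)) (label-local _ _ lab₁)) d₂ ∘ sym

  AuxWalk : AV 𝒯 → AV 𝒯 → Set
  AuxWalk = Walk (Step 𝒯)

  restart : ∀ {s s′ t} → s ≡ s′ → AuxWalk s t → AuxWalk s′ t
  restart {t = t} = subst (λ s → AuxWalk s t)

  interiorNodes-restart : ∀ {s s′ t} (eq : s ≡ s′) (W : AuxWalk s t) → interiorNodes 𝒯 (restart eq W) ≡ interiorNodes 𝒯 W
  interiorNodes-restart refl W = refl

  descentWalk : ∀ {y l} → Descent y l → AuxWalk (inj₂ y) (inj₁ l)
  descentWalk (exit {y} py)                = tree-out y ∷ restart (sym py) []
  descentWalk (enter {y} {e} {x} py lab d) = tree-out y ∷ restart (sym py) (interior e x lab ∷ descentWalk d)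

  descent-route-nodes : ∀ {y l} (d : Descent y l) → routeNodes (descent-route d) ≡ node y ∷ interiorNodes 𝒯 (descentWalk d)
  descent-route-nodes (exit py) = cong (_ ∷_) (sym (interiorNodes-restart (sym py) []))
  descent-route-nodes (enter {e = e} {x} py lab d) = cong (_ ∷_) (begin
    routeNodes (descent-route d)                             ≡⟨ descent-route-nodes d ⟩
    node x ∷ interiorNodes 𝒯 (descentWalk d)                ≡⟨ cong (_∷ interiorNodes 𝒯 (descentWalk d)) (sym (label-local e x lab)) ⟩
    interiorNodes 𝒯 (interior e x lab ∷ descentWalk d)      ≡⟨ sym (interiorNodes-restart (sym py) _) ⟩
    interiorNodes 𝒯 (restart (sym py) (interior e x lab ∷ descentWalk d)) ∎)
    where open ≡-Reasoning

  interiorNodes-tail : ∀ {s v t} (st : Step 𝒯 s v) (W : AuxWalk v t) → interiorNodes 𝒯 W ⊆ interiorNodes 𝒯 (st ∷ W)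
  interiorNodes-tail (tree-out _)     _ = ⊆-refl
  interiorNodes-tail (tree-in _)      _ = ⊆-refl
  interiorNodes-tail (interior _ _ _) _ = _ ∷ʳ ⊆-refl

  interiorNodes-∷-mono : ∀ {s v t} (st : Step 𝒯 s v) {W W′ : AuxWalk v t} →
                         interiorNodes 𝒯 W′ ⊆ interiorNodes 𝒯 W → interiorNodes 𝒯 (st ∷ W′) ⊆ interiorNodes 𝒯 (st ∷ W)
  interiorNodes-∷-mono (tree-out _)     τ = τ
  interiorNodes-∷-mono (tree-in _)      τ = τ
  interiorNodes-∷-mono (interior _ _ _) τ = refl ∷ τ

  suffix : ∀ {s v t} (W : AuxWalk s t) → v ∈ verts W →
           Σ (AuxWalk v t) λ W′ → verts W′ ⊆ verts W × interiorNodes 𝒯 W′ ⊆ interiorNodes 𝒯 W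
  suffix []       (here refl) = [] , ⊆-refl , ⊆-refl
  suffix (st ∷ W) (here refl) = st ∷ W , ⊆-refl , ⊆-refl
  suffix (st ∷ W) (there v∈) with suffix W v∈
  ... | W′ , V⊆ , I⊆ = W′ , _ ∷ʳ V⊆ , ⊆-trans I⊆ (interiorNodes-tail st W)

  walk⇒path : ∀ {s t} (W : AuxWalk s t) → Σ (AuxWalk s t) λ W′ → Unique (verts W′) × interiorNodes 𝒯 W′ ⊆ interiorNodes 𝒯 W
  walk⇒path []  = [] , [] ∷ [] , ⊆-refl
  walk⇒path {s} (st ∷ W) with walk⇒path W
  ... | W′ , u , I⊆ with any? (≡-dec _≟_ _≟_ s) (verts W′)
  ...   | no s∉ = st ∷ W′ , ¬Any⇒All¬ _ s∉ ∷ u , interiorNodes-∷-mono st I⊆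
  ...   | yes s∈ with suffix W′ s∈
  ...     | W″ , V⊆ , I⊆′ = W″ , Unique-resp-⊇ V⊆ u , ⊆-trans I⊆′ (⊆-trans I⊆ (interiorNodes-tail st W))

  alternated-path : ∀ {s t} (W : AuxWalk s t) → Unique (interiorNodes 𝒯 W) → Σ (AuxWalk s t) (IsAlternatedPath 𝒯)
  alternated-path W u with walk⇒path W
  ... | W′ , uV , I⊆ = W′ , uV , Unique-resp-⊇ I⊆ u

  descent-accessible : ∀ {x y a l} → other x ≡ inj₁ a → label x y ≡ true → Descent y l → Accessible 𝒯 a l
  descent-accessible {x} {y} {l = l} pa lab d =
    route-leaves-distinct (descent-route d) (descent-route-origin d) (label⇒≢ lab) (label-local x y lab) pa ,
    alternated-path (restart pa W) (subst Unique (sym (interiorNodes-restart pa W)) unique)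
    where
      W : AuxWalk (other x) (inj₁ l)
      W = tree-in x ∷ interior x y lab ∷ descentWalk d
      unique : Unique (interiorNodes 𝒯 W)
      unique = subst (λ v → Unique (v ∷ interiorNodes 𝒯 (descentWalk d))) (sym (label-local x y lab))
                     (subst Unique (descent-route-nodes d) (routeNodes-unique (descent-route d)))

  step-from-leaf : ∀ {s t l z} → Step 𝒯 s t → s ≡ inj₁ l → other z ≡ inj₁ l → t ≡ inj₂ z
  step-from-leaf (tree-out _)     ()
  step-from-leaf (tree-in x)      ps pz = cong inj₂ (leaf-unique x _ _ ps pz)
  step-from-leaf (interior _ _ _) ()

  leaf-marker-unreachable : ∀ {x y l} → other x ≡ inj₁ l → other y ≢ inj₂ x
  leaf-marker-unreachable px py with trans (sym px) (other-inv _ _ py)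
  ... | ()

  path-from-leaf : ∀ {t b l z} (W : AuxWalk t (inj₁ b)) → t ≡ inj₁ l → other z ≡ inj₁ l →
                   All (inj₂ z ≢_) (verts W) → b ≡ l
  path-from-leaf []       eq _  _        = inj₁-injective eq
  path-from-leaf (st ∷ W) eq pz (_ ∷ z∉) = ⊥-elim (All-verts-head W z∉ (sym (step-from-leaf st eq pz)))

  module _ {u c e lc le} (sc : IsStarCenter 𝒯 u c) (ne : node e ≡ u) (e≢c : e ≢ c)
           (pc : other c ≡ inj₁ lc) (pe : other e ≡ inj₁ le) where

    path-from-center : ∀ {s b} (W : AuxWalk s (inj₁ b)) → s ≡ inj₂ c → Unique (verts W) →
                       All (u ≢_) (interiorNodes 𝒯 W) → b ≡ lc
    path-from-center (tree-out _ ∷ W)     refl (c∉ ∷ _) _          = path-from-leaf W pc pc c∉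
    path-from-center (tree-in _ ∷ _)      eq   _        _          = ⊥-elim (leaf-marker-unreachable pc eq)
    path-from-center (interior _ _ _ ∷ _) refl _        (u≢nc ∷ _) = ⊥-elim (u≢nc (sym (proj₁ sc)))

    path-from-extremity : ∀ {s b} (W : AuxWalk s (inj₁ b)) → s ≡ inj₂ e → All (inj₁ le ≢_) (verts W) →
                          Unique (verts W) → Unique (interiorNodes 𝒯 W) → b ≡ lc
    path-from-extremity (tree-out _ ∷ W) refl (_ ∷ le∉) _ _ = ⊥-elim (All-verts-head W le∉ (sym pe))
    path-from-extremity (tree-in _ ∷ _)  eq   _         _ _ = ⊥-elim (leaf-marker-unreachable pe eq)
    path-from-extremity (interior _ y lab ∷ W) refl _ (_ ∷ uV) (ne∉ ∷ _)
      with Equivalence.to (proj₂ sc e y ne (trans (sym (label-local e y lab)) ne)) lab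
    ... | _ , inj₁ e≡c  = ⊥-elim (e≢c e≡c)
    ... | _ , inj₂ refl = path-from-center W refl uV (subst (λ v → All (v ≢_) (interiorNodes 𝒯 W)) ne ne∉)

    extremity-leaf-neighbour : ∀ {b} → Accessible 𝒯 le b → b ≡ lc
    extremity-leaf-neighbour (le≢b , [] , _) = ⊥-elim (le≢b refl)
    extremity-leaf-neighbour (_ , st ∷ W , (le∉ ∷ uV) , uI) =
      path-from-extremity W (step-from-leaf st refl pe) le∉ uV (Unique-resp-⊇ (interiorNodes-tail st W) uI)

  module _ (G : Graph n) (accessible : IsAccessibilityGraphOf 𝒯 G) where
    open Graph G

    adjacent-via-descent : ∀ {x y a l} → other x ≡ inj₁ a → label x y ≡ true → Descent y l → adj a l ≡ true
    adjacent-via-descent pa lab d = Equivalence.from (accessible _ _) (descent-accessible pa lab d)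

    degree≡1⇒same-neighbour : ∀ {a l₁ l₂} → degree G a ≡ 1 → adj a l₁ ≡ true → adj a l₂ ≡ true → l₁ ≡ l₂
    degree≡1⇒same-neighbour {a} deg adj₁ adj₂ =
      filter-length≡1⇒ (T? ∘ adj a) deg (∈-allFin _) (∈-allFin _) (Equivalence.from T-≡ adj₁) (Equivalence.from T-≡ adj₂)

    unique-neighbour⇒degree≡1 : ∀ {a l} → adj a l ≡ true → (∀ b → adj a b ≡ true → b ≡ l) → degree G a ≡ 1
    unique-neighbour⇒degree≡1 {a} {l} adjₗ only =
      filter-length≡1⇐ (T? ∘ adj a) (allFin⁺ n) (∈-allFin l) (Equivalence.from T-≡ adjₗ)
                       (λ {b} _ adjᵇ → only b (Equivalence.to T-≡ adjᵇ))

    distinct-descents⇒degree≢1 : ∀ {x y₁ y₂ a} → other x ≡ inj₁ a → label x y₁ ≡ true → label x y₂ ≡ true →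
                                 DistinctDescents y₁ y₂ → degree G a ≢ 1
    distinct-descents⇒degree≢1 pa lab₁ lab₂ (_ , _ , d₁ , d₂ , l₁≢l₂) deg =
      l₁≢l₂ (degree≡1⇒same-neighbour deg (adjacent-via-descent pa lab₁ d₁) (adjacent-via-descent pa lab₂ d₂))

    star⇒pendant-edge : HasStarWithLeafCenterAndExtremity 𝒯 → HasPendantEdge G
    star⇒pendant-edge (_ , c , e , sc , (ne , _ , sc₀ , e≢c₀) , (lc , pc) , (le , pe)) =
      le , lc , adj-le-lc , inj₁ (unique-neighbour⇒degree≡1 adj-le-lc only-lc)
      where
        e≢c : e ≢ c
        e≢c e≡c = e≢c₀ (trans e≡c (star-center-unique sc sc₀))
        adj-le-lc : adj le lc ≡ true
        adj-le-lc = adjacent-via-descent pe (extremity-center-label sc ne e≢c) (exit pc)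
        only-lc : ∀ b → adj le b ≡ true → b ≡ lc
        only-lc b adjᵇ = extremity-leaf-neighbour sc ne e≢c pc pe (Equivalence.to (accessible le b) adjᵇ)

    branching⇒degree≢1 : ∀ {x a} → other x ≡ inj₁ a → Branching x → degree G a ≢ 1
    branching⇒degree≢1 pa branching with branching-descents branching
    ... | _ , _ , lab₁ , lab₂ , descents = distinct-descents⇒degree≢1 pa lab₁ lab₂ descents

    extremity⇒star : ∀ {x a} → other x ≡ inj₁ a → IsExtremity 𝒯 (node x) x → degree G a ≡ 1 →
                     HasStarWithLeafCenterAndExtremity 𝒯
    extremity⇒star {x} {a} pa ext@(_ , c , sc , x≢c) deg with other c in pc
    ... | inj₁ lc = node x , c , x , sc , ext , (lc , pc) , (a , pa)
    ... | inj₂ c′ with branching⊎extremity c′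
    ...   | inj₂ ext′ = ⊥-elim (no-center-extremity c c′ pc (subst (λ v → IsStarCenter 𝒯 v c) (sym (proj₁ sc)) sc) ext′)
    ...   | inj₁ branching with branching-descents branching
    ...     | _ , _ , lab₁ , lab₂ , (l₁ , l₂ , d₁ , d₂ , l₁≢l₂) =
      ⊥-elim (distinct-descents⇒degree≢1 pa lab-xc lab-xc (l₁ , l₂ , enter pc lab₁ d₁ , enter pc lab₂ d₂ , l₁≢l₂) deg)
      where
        lab-xc : label x c ≡ true
        lab-xc = extremity-center-label sc refl x≢c

    degree≡1⇒star : ∀ a → degree G a ≡ 1 → HasStarWithLeafCenterAndExtremity 𝒯
    degree≡1⇒star a deg with leaf-attach a
    ... | x , pa with branching⊎extremity x
    ...   | inj₁ branching = ⊥-elim (branching⇒degree≢1 pa branching deg)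
    ...   | inj₂ ext       = extremity⇒star pa ext deg

lemma10 : ∀ {n : ℕ} (G : Graph n) (T : GLT n) →
          IsGLT T → IsReducedCliqueStar T → IsAccessibilityGraphOf T G →
          ((¬ HasPendantEdge G) ⇔ (¬ HasStarWithLeafCenterAndExtremity T))
lemma10 G T isGLT reduced accessible = mk⇔
  (λ no-pendant star → no-pendant (star⇒pendant-edge G accessible star))
  (λ no-star (a , b , _ , degree≡1) → no-star ([ degree≡1⇒star G accessible a , degree≡1⇒star G accessible b ] degree≡1))
  where open Tree T isGLT reduced
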